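{- Let $a\ge 1$ and let $S\in\{\mathtt t,\mathtt d\}^*$ be a feasible $k$-strategy for configuration $(a,a)$. Then $E_{a,a}[S]\ge E_{k,k}[(\mathtt t\mathtt d)^k]$.
   Context: Setting: uniform decremental sets (all items have weight $1$, all inserted at the start, then only deletions) played by the algorithm UniRand, which at each step collects a uniformly random pending item if one exists. A configuration $(a,p)$ means $a$ active items of which $p$ are pending for UniRand, the set of pending items being a uniformly random $p$-subset of the active items. An adversary strategy is a word $S\in\{\mathtt t,\mathtt d\}^*$ of elementary operations: $\mathtt t$ = the adversary collects an item and UniRand collects a uniformly random pending item if it has one; $\mathtt d$ = one active item is deleted. $S$ is feasible for $(a,p)$ if it contains exactly $a$ letters $\mathtt d$ and every suffix of $S$ contains no more $\mathtt t$'s than $\mathtt d$'s; it is a $k$-strategy if it contains exactly $k$ letters $\mathtt t$. $E_{a,p}[S]$ is the expected number of items collected by UniRand starting from configuration $(a,p)$ against $S$; equivalently $E_{a,p}[\varepsilon]=0$, $E_{a,p}[\mathtt t S']=1+E_{a,p-1}[S']$ if $p\ge1$ and $E_{a,0}[\mathtt t S']=E_{a,0}[S']$, and $E_{a,p}[\mathtt d S']=\frac{a-p}{a}E_{a-1,p}[S']+\frac{p}{a}E_{a-1,p-1}[S']$. -}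

module Defs where

open import Data.Nat using (ℕ; zero; suc; _≤_)
open import Data.Integer using (+_)
open import Data.Rational using (ℚ; _+_; _*_; 0ℚ; 1ℚ; _/_)
open import Data.List using (List; []; _∷_; replicate; concat)
open import Data.Product using (_×_)
open import Relation.Binary.PropositionalEquality using (_≡_)

data Op : Set where
  t : Op   -- adversary collects an item; UniRand collects a pending one if any
  d : Op   -- one active item is deleted

#t : List Op → ℕ
#t []      = zero
#t (t ∷ s) = suc (#t s)
#t (d ∷ s) = #t s

#d : List Op → ℕ
#d []      = zero
#d (t ∷ s) = #d s
#d (d ∷ s) = suc (#d s)

data SuffixOK : List Op → Set where
  []  : SuffixOK []
  _∷_ : ∀ {o s} → #t (o ∷ s) ≤ #d (o ∷ s) → SuffixOK s → SuffixOK (o ∷ s)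

Feasible : ℕ → ℕ → List Op → Set
Feasible a p S = (#d S ≡ a) × SuffixOK S

IsKStrategy : ℕ → List Op → Set
IsKStrategy k S = #t S ≡ k

-- E a p S : expected number of items collected by UniRand from (a, p) against S.
-- (The case d with a = 0 never arises for feasible strategies; it is set to 0.)
E : ℕ → ℕ → List Op → ℚ
E a p       []      = 0ℚ
E a zero    (t ∷ s) = E a zero s
E a (suc p) (t ∷ s) = 1ℚ + E a p s
E zero p    (d ∷ s) = 0ℚ
E (suc a) zero    (d ∷ s) = E a zero s
E (suc a) (suc p) (d ∷ s) =
  ((+ (suc a Data.Nat.∸ suc p)) / suc a) * E a (suc p) s
  + ((+ suc p) / suc a) * E a p s

td^ : ℕ → List Op
td^ k = concat (replicate k (t ∷ d ∷ []))

-- Moving an adversary collection t to the right past a deletion d never increases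
-- UniRand's expected gain: this swap inequality rests on E being monotone in the
-- number of pending items, and it survives any common prefix. Pushing every t of a
-- feasible strategy as far right as feasibility allows yields d^(a−k) (t d)^k, and
-- a deletion in a configuration where every item is pending just shrinks (n+1, n+1)
-- to (n, n), so against d^(a−k) (t d)^k UniRand gains exactly E_{k,k}[(t d)^k].
module Submission where

open import Defs
open import Data.Nat using (ℕ; _≥_)
open import Data.List using (List)
open import Data.Rational using (_≤_)

open import Data.Nat as ℕ using (zero; suc; z≤n; s≤s; _∸_)
import Data.Nat.Properties as ℕP
open import Data.Integer as ℤ using (+_)
import Data.Integer.Properties as ℤP
import Data.Integer.Solver
open import Data.Rational as ℚ using (ℚ; _/_; 0ℚ; 1ℚ; _+_; _*_)
import Data.Rational.Properties as ℚP
open ℚP using (≤-refl; ≤-trans; ≤-reflexive; +-mono-≤; +-monoˡ-≤; +-monoʳ-≤)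
import Data.Rational.Solver
import Data.Rational.Unnormalised as ℚᵘ
import Data.Rational.Unnormalised.Properties as ℚᵘP
open import Data.List using ([]; _∷_; replicate; _++_)
open import Data.Product using (_,_)
open import Data.Sum using (inj₁; inj₂)
open import Relation.Binary.PropositionalEquality

ratio : ℕ → ℕ → ℚ
ratio n k = + n / suc k

toℚᵘ-ratio : ∀ n k → ℚ.toℚᵘ (ratio n k) ℚᵘ.≃ ℚᵘ.mkℚᵘ (+ n) k
toℚᵘ-ratio n k = ℚP.toℚᵘ-fromℚᵘ (ℚᵘ.mkℚᵘ (+ n) k)

ratio-+ : ∀ m n k → ratio (m ℕ.+ n) k ≡ ratio m k + ratio n k
ratio-+ m n k = ℚP.toℚᵘ-injective (begin
  ℚ.toℚᵘ (ratio (m ℕ.+ n) k)                  ≈⟨ toℚᵘ-ratio (m ℕ.+ n) k ⟩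
  ℚᵘ.mkℚᵘ (+ (m ℕ.+ n)) k                     ≈⟨ ℚᵘ.*≡* cross-multiplied ⟩
  ℚᵘ.mkℚᵘ (+ m) k ℚᵘ.+ ℚᵘ.mkℚᵘ (+ n) k        ≈⟨ ℚᵘP.+-cong (toℚᵘ-ratio m k) (toℚᵘ-ratio n k) ⟨
  ℚ.toℚᵘ (ratio m k) ℚᵘ.+ ℚ.toℚᵘ (ratio n k)  ≈⟨ ℚP.toℚᵘ-homo-+ (ratio m k) (ratio n k) ⟨
  ℚ.toℚᵘ (ratio m k + ratio n k)              ∎)
  where
  open ℚᵘP.≃-Reasoning
  open Data.Integer.Solver.+-*-Solver
  cross-multiplied : + (m ℕ.+ n) ℤ.* + (suc k ℕ.* suc k)
                   ≡ (+ m ℤ.* + suc k ℤ.+ + n ℤ.* + suc k) ℤ.* + suc k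
  cross-multiplied = trans (cong₂ ℤ._*_ (ℤP.pos-+ m n) (ℤP.pos-* (suc k) (suc k)))
    (solve 3 (λ x y z → (x :+ y) :* (z :* z) := (x :* z :+ y :* z) :* z) refl (+ m) (+ n) (+ suc k))

ratio-self : ∀ k → ratio (suc k) k ≡ 1ℚ
ratio-self k = ℚP.toℚᵘ-injective
  (ℚᵘP.≃-trans (toℚᵘ-ratio (suc k) k) (ℚᵘ.*≡* (ℤP.*-comm (+ suc k) (+ 1))))

ratio-zero : ∀ k → ratio 0 k ≡ 0ℚ
ratio-zero k = ℚP.0/n≡0 (suc k)

ratio-partition : ∀ m n k → m ℕ.+ n ≡ suc k → ratio m k + ratio n k ≡ 1ℚ
ratio-partition m n k m+n≡1+k = begin
  ratio m k + ratio n k  ≡⟨ ratio-+ m n k ⟨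
  ratio (m ℕ.+ n) k      ≡⟨ cong (λ l → ratio l k) m+n≡1+k ⟩
  ratio (suc k) k        ≡⟨ ratio-self k ⟩
  1ℚ                     ∎
  where open ≡-Reasoning

ratio-nonNeg : ∀ n k → 0ℚ ≤ ratio n k
ratio-nonNeg n k = ℚP.nonNegative⁻¹ (ratio n k) {{ℚP.normalize-nonNeg n (suc k)}}

ratio-*-monoʳ-≤ : ∀ n k {x y} → x ≤ y → ratio n k * x ≤ ratio n k * y
ratio-*-monoʳ-≤ n k = ℚP.*-monoˡ-≤-nonNeg (ratio n k) {{ℚP.normalize-nonNeg n (suc k)}}

-- For a ≤ p the truncated subtraction makes the weight ratio 0 a = 0ℚ.
ratio-∸-*-monoʳ-≤ : ∀ a p {x y} → (p ℕ.< a → x ≤ y) → ratio (a ∸ p) a * x ≤ ratio (a ∸ p) a * y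
ratio-∸-*-monoʳ-≤ a p {x} {y} x≤y with ℕP.≤-<-connex a p
... | inj₂ p<a = ratio-*-monoʳ-≤ (a ∸ p) a (x≤y p<a)
... | inj₁ a≤p rewrite ℕP.m≤n⇒m∸n≡0 a≤p | ratio-zero a | ℚP.*-zeroˡ x | ℚP.*-zeroˡ y = ≤-refl

open Data.Rational.Solver.+-*-Solver using (solve; _:+_; _:*_; _:=_; con)

p≤1+p : ∀ p → p ≤ 1ℚ + p
p≤1+p p = ≤-trans (≤-reflexive (sym (ℚP.+-identityˡ p))) (+-monoˡ-≤ p (ℚP.nonNegative⁻¹ 1ℚ))

x≤αy+βx : ∀ α β x y → α + β ≡ 1ℚ → α * x ≤ α * y → x ≤ α * y + β * x
x≤αy+βx α β x y α+β≡1 αx≤αy = begin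
  x              ≡⟨ ℚP.*-identityˡ x ⟨
  1ℚ * x         ≡⟨ cong (_* x) α+β≡1 ⟨
  (α + β) * x    ≡⟨ ℚP.*-distribʳ-+ x α β ⟩
  α * x + β * x  ≤⟨ +-monoˡ-≤ (β * x) αx≤αy ⟩
  α * y + β * x  ∎
  where open ℚP.≤-Reasoning

[γ+A]x₁+Bx₀≤Ax₂+[γ+B]x₁ : ∀ γ A B x₀ x₁ x₂ → A * x₁ ≤ A * x₂ → B * x₀ ≤ B * x₁ →
                          (γ + A) * x₁ + B * x₀ ≤ A * x₂ + (γ + B) * x₁
[γ+A]x₁+Bx₀≤Ax₂+[γ+B]x₁ γ A B x₀ x₁ x₂ Ax₁≤Ax₂ Bx₀≤Bx₁ = begin
  (γ + A) * x₁ + B * x₀      ≡⟨ solve 5 (λ g a b u v → (g :+ a) :* v :+ b :* u := a :* v :+ (b :* u :+ g :* v))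
                                  refl γ A B x₀ x₁ ⟩
  A * x₁ + (B * x₀ + γ * x₁) ≤⟨ +-mono-≤ Ax₁≤Ax₂ (+-monoˡ-≤ (γ * x₁) Bx₀≤Bx₁) ⟩
  A * x₂ + (B * x₁ + γ * x₁) ≡⟨ solve 5 (λ g a b u v → a :* u :+ (b :* v :+ g :* v) := a :* u :+ (g :+ b) :* v)
                                  refl γ A B x₂ x₁ ⟩
  A * x₂ + (γ + B) * x₁      ∎
  where open ℚP.≤-Reasoning

α[1+x]+βx≤1+x : ∀ α β x → α + β ≡ 1ℚ → 0ℚ ≤ β → α * (1ℚ + x) + β * x ≤ 1ℚ + x
α[1+x]+βx≤1+x α β x α+β≡1 0≤β = begin
  α * (1ℚ + x) + β * x  ≡⟨ solve 3 (λ a b u → a :* (con 1ℚ :+ u) :+ b :* u := a :+ (a :+ b) :* u) refl α β x ⟩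
  α + (α + β) * x       ≡⟨ cong (λ r → α + r * x) α+β≡1 ⟩
  α + 1ℚ * x            ≡⟨ cong (λ r → α + r) (ℚP.*-identityˡ x) ⟩
  α + x                 ≤⟨ +-monoˡ-≤ x α≤1 ⟩
  1ℚ + x                ∎
  where
  open ℚP.≤-Reasoning
  α≤1 : α ≤ 1ℚ
  α≤1 = begin
    α       ≡⟨ ℚP.+-identityʳ α ⟨
    α + 0ℚ  ≤⟨ +-monoʳ-≤ α 0≤β ⟩
    α + β   ≡⟨ α+β≡1 ⟩
    1ℚ      ∎

A[1+y]+[γ+B][1+x]≤1+[γ+A]y+Bx : ∀ γ A B x y → A + (γ + B) ≡ 1ℚ → γ * x ≤ γ * y →
                                A * (1ℚ + y) + (γ + B) * (1ℚ + x) ≤ 1ℚ + ((γ + A) * y + B * x)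
A[1+y]+[γ+B][1+x]≤1+[γ+A]y+Bx γ A B x y A+γ+B≡1 γx≤γy = begin
  A * (1ℚ + y) + (γ + B) * (1ℚ + x)
    ≡⟨ solve 5 (λ g a b u v → a :* (con 1ℚ :+ v) :+ (g :+ b) :* (con 1ℚ :+ u)
                            := (a :+ (g :+ b)) :+ (a :* v :+ b :* u) :+ g :* u) refl γ A B x y ⟩
  (A + (γ + B)) + (A * y + B * x) + γ * x
    ≡⟨ cong (λ r → r + (A * y + B * x) + γ * x) A+γ+B≡1 ⟩
  (1ℚ + (A * y + B * x)) + γ * x
    ≤⟨ +-monoʳ-≤ (1ℚ + (A * y + B * x)) γx≤γy ⟩
  (1ℚ + (A * y + B * x)) + γ * y
    ≡⟨ solve 5 (λ g a b u v → (con 1ℚ :+ (a :* v :+ b :* u)) :+ g :* v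
                            := con 1ℚ :+ ((g :+ a) :* v :+ b :* u)) refl γ A B x y ⟩
  1ℚ + ((γ + A) * y + B * x)
    ∎
  where open ℚP.≤-Reasoning

E-mono-pending : ∀ S a p → p ℕ.< a → E a p S ≤ E a (suc p) S
E-mono-pending []      a p       _   = ≤-refl
E-mono-pending (t ∷ s) a zero    _   = p≤1+p (E a 0 s)
E-mono-pending (t ∷ s) a (suc p) p<a = +-monoʳ-≤ 1ℚ (E-mono-pending s a p (ℕP.<-trans (ℕP.n<1+n p) p<a))
E-mono-pending (d ∷ s) (suc a) zero _ =
  x≤αy+βx (ratio a a) (ratio 1 a) (E a 0 s) (E a 1 s) (ratio-partition a 1 a (ℕP.+-comm a 1))
    (ratio-∸-*-monoʳ-≤ a 0 (E-mono-pending s a 0))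
E-mono-pending (d ∷ s) (suc a) (suc p) (s≤s p<a) rewrite ℕP.+-∸-assoc 1 p<a = begin
  ratio (suc m) a * x₁ + ratio (suc p) a * x₀                ≡⟨ cong (λ r → r * x₁ + ratio (suc p) a * x₀) (ratio-+ 1 m a) ⟩
  (ratio 1 a + ratio m a) * x₁ + ratio (suc p) a * x₀
    ≤⟨ [γ+A]x₁+Bx₀≤Ax₂+[γ+B]x₁ (ratio 1 a) (ratio m a) (ratio (suc p) a) x₀ x₁ x₂
         (ratio-∸-*-monoʳ-≤ a (suc p) (E-mono-pending s a (suc p)))
         (ratio-*-monoʳ-≤ (suc p) a (E-mono-pending s a p p<a)) ⟩
  ratio m a * x₂ + (ratio 1 a + ratio (suc p) a) * x₁        ≡⟨ cong (λ r → ratio m a * x₂ + r * x₁) (ratio-+ 1 (suc p) a) ⟨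
  ratio m a * x₂ + ratio (suc (suc p)) a * x₁                ∎
  where
  open ℚP.≤-Reasoning
  m = a ∸ suc p
  x₀ = E a p s
  x₁ = E a (suc p) s
  x₂ = E a (suc (suc p)) s

infix 4 _⊑[_]_

-- A record rather than a function type, so that X and Y can be inferred (E is not injective).
record _⊑[_]_ (X : List Op) (a : ℕ) (Y : List Op) : Set where
  constructor dominated
  field ≤-at : ∀ p → p ℕ.≤ a → E a p X ≤ E a p Y
open _⊑[_]_

⊑-refl : ∀ {X a} → X ⊑[ a ] X
⊑-refl = dominated λ _ _ → ≤-refl

⊑-trans : ∀ {X Y Z a} → X ⊑[ a ] Y → Y ⊑[ a ] Z → X ⊑[ a ] Z
⊑-trans X⊑Y Y⊑Z = dominated λ p p≤a → ≤-trans (≤-at X⊑Y p p≤a) (≤-at Y⊑Z p p≤a)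

t∷-⊑ : ∀ {X Y a} → X ⊑[ a ] Y → (t ∷ X) ⊑[ a ] (t ∷ Y)
t∷-⊑ X⊑Y = dominated λ where
  zero    0≤a → ≤-at X⊑Y 0 0≤a
  (suc p) p<a → +-monoʳ-≤ 1ℚ (≤-at X⊑Y p (ℕP.<⇒≤ p<a))

d∷-⊑ : ∀ {X Y a} → X ⊑[ a ] Y → (d ∷ X) ⊑[ suc a ] (d ∷ Y)
d∷-⊑ {a = a} X⊑Y = dominated λ where
  zero    _         → ≤-at X⊑Y 0 z≤n
  (suc p) (s≤s p≤a) → +-mono-≤ (ratio-∸-*-monoʳ-≤ a p (≤-at X⊑Y (suc p)))
                               (ratio-*-monoʳ-≤ (suc p) a (≤-at X⊑Y p p≤a))

E-swap : ∀ a Z p → p ℕ.≤ a → E a p (d ∷ t ∷ Z) ≤ E a p (t ∷ d ∷ Z)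
E-swap zero    Z zero          _ = ≤-refl
E-swap (suc a) Z zero          _ = ≤-refl
E-swap (suc a) Z (suc zero)    _ =
  α[1+x]+βx≤1+x (ratio a a) (ratio 1 a) (E a 0 Z) (ratio-partition a 1 a (ℕP.+-comm a 1)) (ratio-nonNeg 1 a)
E-swap (suc a) Z (suc (suc p)) (s≤s p<a) rewrite ℕP.+-∸-assoc 1 p<a = begin
  ratio m a * (1ℚ + y) + ratio (suc (suc p)) a * (1ℚ + x)
    ≡⟨ cong (λ r → ratio m a * (1ℚ + y) + r * (1ℚ + x)) (ratio-+ 1 (suc p) a) ⟩
  ratio m a * (1ℚ + y) + (ratio 1 a + ratio (suc p) a) * (1ℚ + x)
    ≤⟨ A[1+y]+[γ+B][1+x]≤1+[γ+A]y+Bx (ratio 1 a) (ratio m a) (ratio (suc p) a) x y weights-sum-to-1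
         (ratio-*-monoʳ-≤ 1 a (E-mono-pending Z a p p<a)) ⟩
  1ℚ + ((ratio 1 a + ratio m a) * y + ratio (suc p) a * x)
    ≡⟨ cong (λ r → 1ℚ + (r * y + ratio (suc p) a * x)) (ratio-+ 1 m a) ⟨
  1ℚ + (ratio (suc m) a * y + ratio (suc p) a * x)
    ∎
  where
  open ℚP.≤-Reasoning
  m = a ∸ suc p
  x = E a p Z
  y = E a (suc p) Z
  weights-sum-to-1 : ratio m a + (ratio 1 a + ratio (suc p) a) ≡ 1ℚ
  weights-sum-to-1 = begin-equality
    ratio m a + (ratio 1 a + ratio (suc p) a)  ≡⟨ cong (λ r → ratio m a + r) (ratio-+ 1 (suc p) a) ⟨
    ratio m a + ratio (suc (suc p)) a          ≡⟨ ratio-partition m (suc (suc p)) a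
                                                    (trans (ℕP.+-suc m (suc p)) (cong suc (ℕP.m∸n+n≡m p<a))) ⟩
    1ℚ                                         ∎

d^ : ℕ → List Op
d^ m = replicate m d

d^-snoc : ∀ m X → d^ (suc m) ++ X ≡ d^ m ++ d ∷ X
d^-snoc zero    X = refl
d^-snoc (suc m) X = cong (d ∷_) (d^-snoc m X)

d^-t-⊑ : ∀ m a W → (d^ m ++ t ∷ W) ⊑[ a ] (t ∷ d^ m ++ W)
d^-t-⊑ zero    a       W = ⊑-refl
d^-t-⊑ (suc m) zero    W = dominated λ where zero _ → ≤-refl
d^-t-⊑ (suc m) (suc a) W = ⊑-trans (d∷-⊑ (d^-t-⊑ m a W)) (dominated (E-swap (suc a) (d^ m ++ W)))

normalForm : ℕ → ℕ → List Op
normalForm a k = d^ (a ∸ k) ++ td^ k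

#t≤#d : ∀ {S} → SuffixOK S → #t S ℕ.≤ #d S
#t≤#d []      = z≤n
#t≤#d (h ∷ _) = h

normalForm-⊑ : ∀ S → SuffixOK S → normalForm (#d S) (#t S) ⊑[ #d S ] S
normalForm-⊑ []      []        = ⊑-refl
normalForm-⊑ (d ∷ s) (_ ∷ ok)  =
  subst (_⊑[ suc (#d s) ] (d ∷ s)) (sym (cong (λ n → d^ n ++ td^ (#t s)) (ℕP.+-∸-assoc 1 (#t≤#d ok))))
    (d∷-⊑ (normalForm-⊑ s ok))
normalForm-⊑ (t ∷ s) (k<a ∷ ok) =
  ⊑-trans (d^-t-⊑ (a ∸ suc k) a (d ∷ td^ k))
    (subst (_⊑[ a ] (t ∷ s)) (cong (t ∷_) t-moved) (t∷-⊑ (normalForm-⊑ s ok)))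
  where
  a = #d s
  k = #t s
  t-moved : normalForm a k ≡ d^ (a ∸ suc k) ++ d ∷ td^ k
  t-moved = trans (cong (λ n → d^ n ++ td^ k) (ℕP.+-∸-assoc 1 k<a)) (d^-snoc (a ∸ suc k) (td^ k))

E-d-all-pending : ∀ n s → E (suc n) (suc n) (d ∷ s) ≡ E n n s
E-d-all-pending n s = begin
  ratio (n ∸ n) n * E n (suc n) s + ratio (suc n) n * E n n s
    ≡⟨ cong₂ (λ i r → ratio i n * E n (suc n) s + r * E n n s) (ℕP.n∸n≡0 n) (ratio-self n) ⟩
  ratio 0 n * E n (suc n) s + 1ℚ * E n n s
    ≡⟨ cong₂ _+_ (trans (cong (_* E n (suc n) s) (ratio-zero n)) (ℚP.*-zeroˡ (E n (suc n) s)))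
                 (ℚP.*-identityˡ (E n n s)) ⟩
  0ℚ + E n n s
    ≡⟨ ℚP.+-identityˡ (E n n s) ⟩
  E n n s
    ∎
  where open ≡-Reasoning

E-d^-all-pending : ∀ m k X → E (m ℕ.+ k) (m ℕ.+ k) (d^ m ++ X) ≡ E k k X
E-d^-all-pending zero    k X = refl
E-d^-all-pending (suc m) k X = trans (E-d-all-pending (m ℕ.+ k) (d^ m ++ X)) (E-d^-all-pending m k X)

lemma3 : (a k : ℕ) → a ≥ 1 → (S : List Op) → Feasible a a S → IsKStrategy k S →
         E k k (td^ k) ≤ E a a S
lemma3 .(#d S) .(#t S) _ S (refl , ok) refl = begin
  E k k (td^ k)                               ≡⟨ E-d^-all-pending (a ∸ k) k (td^ k) ⟨
  E (a ∸ k ℕ.+ k) (a ∸ k ℕ.+ k) (normalForm a k) ≡⟨ cong (λ n → E n n (normalForm a k)) (ℕP.m∸n+n≡m (#t≤#d ok)) ⟩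
  E a a (normalForm a k)                      ≤⟨ ≤-at (normalForm-⊑ S ok) a ℕP.≤-refl ⟩
  E a a S                                     ∎
  where
  open ℚP.≤-Reasoning
  a = #d S
  k = #t S
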